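{- Let $U$ be a finite set and $g:\mathcal{F}\to\mathbf{Z}$ an intersecting-supermodular function on $U$. For every $u\in\bigcup\mathcal{E}[g]$, we have $P[g](u)\in\mathcal{E}[g]$ and $d[g](u)=g(P[g](u))\geq 2$. For every $u\in U\setminus\bigcup\mathcal{E}[g]$, we have $P[g](u)=\{u\}$ and $d[g](u)=1$.
   Context: Two sets $X,Y\subseteq U$ are intersecting if none of $X\cap Y$, $X\setminus Y$, $Y\setminus X$ is empty. A family $\mathcal{F}\subseteq 2^{U}$ is an intersecting family if every intersecting pair $X,Y\in\mathcal{F}$ satisfies $X\cup Y, X\cap Y\in\mathcal{F}$. A function $g:\mathcal{F}\to\mathbf{Z}$ is intersecting-supermodular if $\mathcal{F}$ is an intersecting family and $g(X)+g(Y)\leq g(X\cup Y)+g(X\cap Y)$ for every intersecting pair $X,Y\in\mathcal{F}$. $\mathcal{E}[g]:=\{X\in\mathcal{F}\mid g(X)\geq 2,\ \text{there is no } X'\in\mathcal{F} \text{ with } X'\subsetneq X,\ g(X')\geq g(X)\}$; $d[g](u)=\max\{1,\max\{g(X)\mid u\in X\in\mathcal{E}[g]\}\}$ (inner maximum $-\infty$ if empty). $\mathcal{P}[g]$ consists of the maximal members of $\mathcal{E}[g]$ together with the singletons $\{u\}$ for $u\in U\setminus\bigcup\mathcal{E}[g]$; it is a partition of $U$ (the bunch partition), and $P[g](u)$ denotes the unique part of $\mathcal{P}[g]$ containing $u$. -}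

module Defs where

open import Data.Nat using (ℕ)
open import Data.Bool using (Bool; T)
open import Data.Integer using (ℤ; +_; _+_; _≤_)
open import Data.Fin using (Fin)
open import Data.Fin.Subset using (Subset; _∈_; _∉_; _⊂_; _∩_; _∪_; _─_; Nonempty; ⁅_⁆)
open import Data.Product using (_×_; ∃; ∃-syntax)
open import Data.Sum using (_⊎_)
open import Relation.Nullary using (¬_)
open import Relation.Binary.PropositionalEquality using (_≡_)

-- A family 𝓕 ⊆ 2^U is given by its
-- characteristic function F : Subset n → Bool (X ∈ 𝓕 iff T (F X)).
-- A function g : 𝓕 → ℤ is represented by g : Subset n → ℤ, of which only
-- the values on members of 𝓕 are ever used.

Family : ℕ → Set
Family n = Subset n → Bool

_∈F_ : ∀ {n} → Subset n → Family n → Set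
X ∈F F = T (F X)

Intersecting : ∀ {n} → Subset n → Subset n → Set
Intersecting X Y = Nonempty (X ∩ Y) × Nonempty (X ─ Y) × Nonempty (Y ─ X)

IntersectingFamily : ∀ {n} → Family n → Set
IntersectingFamily {n} F =
  ∀ (X Y : Subset n) → X ∈F F → Y ∈F F → Intersecting X Y →
  ((X ∪ Y) ∈F F) × ((X ∩ Y) ∈F F)

IntersectingSupermodular : ∀ {n} → Family n → (Subset n → ℤ) → Set
IntersectingSupermodular {n} F g =
  IntersectingFamily F ×
  (∀ (X Y : Subset n) → X ∈F F → Y ∈F F → Intersecting X Y →
     g X + g Y ≤ g (X ∪ Y) + g (X ∩ Y))

InE : ∀ {n} → Family n → (Subset n → ℤ) → Subset n → Set
InE {n} F g X =
  X ∈F F × (+ 2 ≤ g X) ×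
  ¬ (∃[ X' ] (X' ∈F F × X' ⊂ X × g X ≤ g X'))

InUnionE : ∀ {n} → Family n → (Subset n → ℤ) → Fin n → Set
InUnionE F g u = ∃[ X ] (InE F g X × u ∈ X)

MaximalE : ∀ {n} → Family n → (Subset n → ℤ) → Subset n → Set
MaximalE F g X = InE F g X × ¬ (∃[ Y ] (InE F g Y × X ⊂ Y))

InP : ∀ {n} → Family n → (Subset n → ℤ) → Subset n → Set
InP F g X = MaximalE F g X ⊎ (∃[ u ] (¬ InUnionE F g u × X ≡ ⁅ u ⁆))

IsPartOf : ∀ {n} → Family n → (Subset n → ℤ) → Fin n → Subset n → Set
IsPartOf F g u X = InP F g X × u ∈ X

-- d[g](u) ≡ m, i.e. m = max{1, max{g X | u ∈ X ∈ 𝓔[g]}}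
-- (m is an upper bound of 1 and of every such g X, and is attained).
IsD : ∀ {n} → Family n → (Subset n → ℤ) → Fin n → ℤ → Set
IsD {n} F g u m =
  (+ 1 ≤ m) ×
  (∀ (X : Subset n) → InE F g X → u ∈ X → g X ≤ m) ×
  (m ≡ + 1 ⊎ ∃[ X ] (InE F g X × u ∈ X × g X ≡ m))

module Submission where

-- The heart of the matter is an exchange argument: if P ∈ 𝓔[g] and some
-- Y ∈ 𝓔[g] crosses P, then P is strictly contained in another member of
-- 𝓔[g].  Indeed V = Y ∪ P lies in 𝓕 and, by supermodularity and the
-- minimality built into 𝓔[g], g V exceeds both g Y and g P.  A minimal
-- W ⊆ V in 𝓕 with g W ≥ g V belongs to 𝓔[g]; comparing W with P, either
-- P ⊂ W, or W crosses P with W ∪ P ⊊ V and we recurse on the smaller union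
-- (the remaining positions contradict g W ≥ g V).  Consequently, a maximal
-- P ∈ 𝓔[g] containing u dominates every X ∈ 𝓔[g] containing u, so g P is
-- d[g](u).

open import Defs
open import Data.Nat using (ℕ)
open import Data.Integer using (ℤ; +_; _≤_)
open import Data.Fin using (Fin)
open import Data.Fin.Subset using (Subset; ⁅_⁆)
open import Data.Product using (_×_; ∃-syntax)
open import Relation.Nullary using (¬_)
open import Relation.Binary.PropositionalEquality using (_≡_)

open import Data.Nat using (_∸_; s≤s; z≤n) renaming (_<_ to _<ℕ_)
open import Data.Nat.Properties using (∸-monoʳ-<)
open import Data.Nat.Induction using (<-wellFounded)
open import Data.Integer using (_+_; _<_; +≤+)
open import Data.Integer.Properties using (≤-refl; ≤-trans; <⇒≤; <⇒≱; ≰⇒>; +-mono-≤-<; _≤?_)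
open import Data.Fin.Subset using (_∈_; _∉_; _⊆_; _⊂_; _∩_; _∪_; _─_; Nonempty; ∣_∣; inside; outside)
open import Data.Fin.Subset.Properties
  using ( _∈?_; nonempty?; anySubset?; _⊂?_; ⊆-refl; ⊆-trans; ⊆-antisym; ∪-comm
        ; x∈p∩q⁺; x∈p∩q⁻; x∈p∪q⁻; p∩q⊆q; q⊆p∪q; x∈p∧x∉q⇒x∈p─q
        ; p⊂q⇒∣p∣<∣q∣; ∣p∣≤n; x∈⁅x⁆; x∈⁅y⁆⇒x≡y )
open import Data.Vec using (_∷_; here; there)
open import Data.Product using (_,_; proj₁; proj₂; swap)
open import Data.Sum using (_⊎_; inj₁; inj₂)
open import Data.Empty using (⊥-elim)
open import Data.Bool.Properties using (T?)
open import Function using (flip)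
open import Induction.WellFounded using (WellFounded; Acc; acc; module Subrelation)
import Relation.Binary.Construct.On as On
open import Relation.Nullary using (Dec; yes; no; ¬?)
open import Relation.Nullary.Decidable using (_×-dec_)
open import Relation.Binary.PropositionalEquality using (refl; subst)

x∈p─q⁻ : ∀ {n} {x : Fin n} (p q : Subset n) → x ∈ p ─ q → x ∈ p × x ∉ q
x∈p─q⁻ (s ∷ p) (inside ∷ q) (there x∈) with x∈p─q⁻ p q x∈
... | x∈p , x∉q = there x∈p , λ { (there x∈q) → x∉q x∈q }
x∈p─q⁻ (s ∷ p) (outside ∷ q) here = here , λ ()
x∈p─q⁻ (s ∷ p) (outside ∷ q) (there x∈) with x∈p─q⁻ p q x∈
... | x∈p , x∉q = there x∈p , λ { (there x∈q) → x∉q x∈q }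

empty─⇒⊆ : ∀ {n} (p q : Subset n) → ¬ Nonempty (p ─ q) → p ⊆ q
empty─⇒⊆ p q p─q-empty {x} x∈p with x ∈? q
... | yes x∈q = x∈q
... | no x∉q = ⊥-elim (p─q-empty (x , x∈p∧x∉q⇒x∈p─q x∈p x∉q))

⊆⇒≡⊎⊂ : ∀ {n} {p q : Subset n} → p ⊆ q → p ≡ q ⊎ p ⊂ q
⊆⇒≡⊎⊂ {p = p} {q} p⊆q with nonempty? (q ─ p)
... | no q─p-empty = inj₁ (⊆-antisym p⊆q (empty─⇒⊆ q p q─p-empty))
... | yes (x , x∈q─p) = inj₂ (p⊆q , x , x∈p─q⁻ q p x∈q─p)

∪-least : ∀ {n} {p q r : Subset n} → p ⊆ r → q ⊆ r → p ∪ q ⊆ r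
∪-least {p = p} {q} p⊆r q⊆r x∈p∪q with x∈p∪q⁻ p q x∈p∪q
... | inj₁ x∈p = p⊆r x∈p
... | inj₂ x∈q = q⊆r x∈q

⊆∪-avoiding : ∀ {n} {p q r : Subset n} → p ⊆ q ∪ r → ¬ Nonempty (p ∩ r) → p ⊆ q
⊆∪-avoiding {q = q} {r} p⊆q∪r p∩r-empty {x} x∈p with x∈p∪q⁻ q r (p⊆q∪r x∈p)
... | inj₁ x∈q = x∈q
... | inj₂ x∈r = ⊥-elim (p∩r-empty (x , x∈p∩q⁺ (x∈p , x∈r)))

Intersecting-sym : ∀ {n} {X Y : Subset n} → Intersecting X Y → Intersecting Y X
Intersecting-sym {X = X} {Y} ((x , x∈X∩Y) , X─Y , Y─X) =
  (x , x∈p∩q⁺ (swap (x∈p∩q⁻ X Y x∈X∩Y))) , Y─X , X─Y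

∩⊂ʳ : ∀ {n} {X Y : Subset n} → Intersecting X Y → X ∩ Y ⊂ Y
∩⊂ʳ {X = X} {Y} (_ , _ , (y , y∈Y─X)) with x∈p─q⁻ Y X y∈Y─X
... | y∈Y , y∉X = p∩q⊆q X Y , y , y∈Y , λ y∈X∩Y → y∉X (proj₁ (x∈p∩q⁻ X Y y∈X∩Y))

data Position {n : ℕ} (X Y : Subset n) : Set where
  contained : X ⊆ Y → Position X Y
  contains  : Y ⊂ X → Position X Y
  disjoint  : ¬ Nonempty (X ∩ Y) → Position X Y
  crossing  : Intersecting X Y → Position X Y

position : ∀ {n} (X Y : Subset n) → Position X Y
position X Y with nonempty? (X ─ Y)
... | no X─Y-empty = contained (empty─⇒⊆ X Y X─Y-empty)
... | yes X─Y with nonempty? (Y ─ X)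
...   | no Y─X-empty = contains (empty─⇒⊆ Y X Y─X-empty , proj₁ X─Y , x∈p─q⁻ X Y (proj₂ X─Y))
...   | yes Y─X with nonempty? (X ∩ Y)
...     | no X∩Y-empty = disjoint X∩Y-empty
...     | yes X∩Y = crossing (X∩Y , X─Y , Y─X)

-- Strict inclusion is well founded in both directions on Subset n, since
-- it strictly increases the cardinality, which is bounded by n.
⊂-wellFounded : ∀ {n} → WellFounded (_⊂_ {n})
⊂-wellFounded = Subrelation.wellFounded p⊂q⇒∣p∣<∣q∣ (On.wellFounded ∣_∣ <-wellFounded)

⊃-wellFounded : ∀ {n} → WellFounded (flip (_⊂_ {n}))
⊃-wellFounded {n} =
  Subrelation.wellFounded (λ {p} {q} q⊂p → ∸-monoʳ-< (p⊂q⇒∣p∣<∣q∣ q⊂p) (∣p∣≤n p))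
    (On.wellFounded (λ p → n ∸ ∣ p ∣) <-wellFounded)

module Extremal {n : ℕ} (Q : Subset n → Set) (Q? : ∀ X → Dec (Q X)) where

  minimal-below : ∀ Y → Q Y → ∃[ Z ] (Q Z × Z ⊆ Y × ¬ (∃[ W ] (Q W × W ⊂ Z)))
  minimal-below Y = descend Y (⊂-wellFounded Y)
    where
    descend : ∀ Y → Acc _⊂_ Y → Q Y → ∃[ Z ] (Q Z × Z ⊆ Y × ¬ (∃[ W ] (Q W × W ⊂ Z)))
    descend Y (acc smaller) qY with anySubset? (λ W → Q? W ×-dec (W ⊂? Y))
    ... | no none-below = Y , qY , ⊆-refl , none-below
    ... | yes (W , qW , W⊂Y) with descend W (smaller W⊂Y) qW
    ...   | Z , qZ , Z⊆W , Z-minimal = Z , qZ , ⊆-trans Z⊆W (proj₁ W⊂Y) , Z-minimal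

  maximal-above : ∀ Y → Q Y → ∃[ Z ] (Q Z × Y ⊆ Z × ¬ (∃[ W ] (Q W × Z ⊂ W)))
  maximal-above Y = ascend Y (⊃-wellFounded Y)
    where
    ascend : ∀ Y → Acc (flip _⊂_) Y → Q Y → ∃[ Z ] (Q Z × Y ⊆ Z × ¬ (∃[ W ] (Q W × Z ⊂ W)))
    ascend Y (acc larger) qY with anySubset? (λ W → Q? W ×-dec (Y ⊂? W))
    ... | no none-above = Y , qY , ⊆-refl , none-above
    ... | yes (W , qW , Y⊂W) with ascend W (larger Y⊂W) qW
    ...   | Z , qZ , W⊆Z , Z-maximal = Z , qZ , ⊆-trans (proj₁ Y⊂W) W⊆Z , Z-maximal

cancel-< : ∀ {a b c d : ℤ} → a + b ≤ c + d → d < b → a < c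
cancel-< a+b≤c+d d<b = ≰⇒> (λ c≤a → <⇒≱ (+-mono-≤-< c≤a d<b) a+b≤c+d)

module Bunches {n : ℕ} (F : Family n) (g : Subset n → ℤ)
               (SM : IntersectingSupermodular F g) where

  E : Subset n → Set
  E = InE F g

  E? : ∀ X → Dec (E X)
  E? X = T? (F X) ×-dec ((+ 2 ≤? g X) ×-dec ¬? (anySubset? λ X' →
           T? (F X') ×-dec ((X' ⊂? X) ×-dec (g X ≤? g X'))))

  E-strict : ∀ {X Z} → E X → Z ∈F F → Z ⊂ X → g Z < g X
  E-strict (_ , _ , no-better) Z∈F Z⊂X = ≰⇒> λ gX≤gZ → no-better (_ , Z∈F , Z⊂X , gX≤gZ)

  E-dominates : ∀ {X Z} → E X → Z ∈F F → Z ⊆ X → g Z ≤ g X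
  E-dominates eX Z∈F Z⊆X with ⊆⇒≡⊎⊂ Z⊆X
  ... | inj₁ refl = ≤-refl
  ... | inj₂ Z⊂X = <⇒≤ (E-strict eX Z∈F Z⊂X)

  union-gainˡ : ∀ {X Y} → E X → E Y → Intersecting X Y → g X < g (X ∪ Y)
  union-gainˡ {X} {Y} eX eY X⋈Y =
    cancel-< (proj₂ SM X Y (proj₁ eX) (proj₁ eY) X⋈Y)
             (E-strict eY (proj₂ (proj₁ SM X Y (proj₁ eX) (proj₁ eY) X⋈Y)) (∩⊂ʳ X⋈Y))

  union-gainʳ : ∀ {X Y} → E X → E Y → Intersecting X Y → g Y < g (X ∪ Y)
  union-gainʳ {X} {Y} eX eY X⋈Y =
    subst (λ Z → g Y < g Z) (∪-comm Y X) (union-gainˡ eY eX (Intersecting-sym X⋈Y))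

  -- Every X ∈ 𝓕 with g X ≥ 2 contains a member of 𝓔[g] worth at least g X:
  -- take an inclusion-minimal W ⊆ X in 𝓕 with g W ≥ g X.
  E-below : ∀ {X} → X ∈F F → + 2 ≤ g X → ∃[ W ] (E W × W ⊆ X × g X ≤ g W)
  E-below {X} X∈F two≤gX = from-minimal (Extremal.minimal-below Q Q? X (X∈F , ≤-refl))
    where
    Q : Subset n → Set
    Q W = W ∈F F × g X ≤ g W
    Q? : ∀ W → Dec (Q W)
    Q? W = T? (F W) ×-dec (g X ≤? g W)
    from-minimal : ∃[ W ] (Q W × W ⊆ X × ¬ (∃[ W' ] (Q W' × W' ⊂ W))) →
                   ∃[ W ] (E W × W ⊆ X × g X ≤ g W)
    from-minimal (W , (W∈F , gX≤gW) , W⊆X , W-minimal) =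
      W , (W∈F , ≤-trans two≤gX gX≤gW , λ { (X' , X'∈F , X'⊂W , gW≤gX') →
             W-minimal (X' , (X'∈F , ≤-trans gX≤gW gW≤gX') , X'⊂W) }) ,
      W⊆X , gX≤gW

  crossing-extends : ∀ {P Y} → E P → E Y → Intersecting Y P → ∃[ W ] (E W × P ⊂ W)
  crossing-extends {P} {Y} eP = go Y (On.wellFounded (λ Y → ∣ Y ∪ P ∣) <-wellFounded Y)
    where
    go : ∀ Y → Acc (λ Y Y' → ∣ Y ∪ P ∣ <ℕ ∣ Y' ∪ P ∣) Y →
         E Y → Intersecting Y P → ∃[ W ] (E W × P ⊂ W)
    go Y (acc smaller) eY Y⋈P = extend (E-below V∈F (≤-trans (proj₁ (proj₂ eP)) (<⇒≤ gP<gV)))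
      where
      V∈F : (Y ∪ P) ∈F F
      V∈F = proj₁ (proj₁ SM Y P (proj₁ eY) (proj₁ eP) Y⋈P)
      gP<gV : g P < g (Y ∪ P)
      gP<gV = union-gainʳ eY eP Y⋈P
      extend : ∃[ W ] (E W × W ⊆ Y ∪ P × g (Y ∪ P) ≤ g W) → ∃[ W ] (E W × P ⊂ W)
      extend (W , eW , W⊆V , gV≤gW) with position W P
      ... | contains P⊂W = W , eW , P⊂W
      ... | contained W⊆P =
        ⊥-elim (<⇒≱ gP<gV (≤-trans gV≤gW (E-dominates eP (proj₁ eW) W⊆P)))
      ... | disjoint W∩P-empty =
        ⊥-elim (<⇒≱ (union-gainˡ eY eP Y⋈P)
                    (≤-trans gV≤gW (E-dominates eY (proj₁ eW) (⊆∪-avoiding W⊆V W∩P-empty))))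
      ... | crossing W⋈P with ⊆⇒≡⊎⊂ (∪-least W⊆V (q⊆p∪q Y P))
      ...   | inj₁ W∪P≡V =
        ⊥-elim (<⇒≱ (subst (λ Z → g W < g Z) W∪P≡V (union-gainˡ eW eP W⋈P)) gV≤gW)
      ...   | inj₂ W∪P⊂V = go W (smaller (p⊂q⇒∣p∣<∣q∣ W∪P⊂V)) eW W⋈P

  maximal-dominates : ∀ {P X u} → MaximalE F g P → E X → u ∈ X → u ∈ P → g X ≤ g P
  maximal-dominates {P} {X} {u} (eP , P-maximal) eX u∈X u∈P with position X P
  ... | contained X⊆P = E-dominates eP (proj₁ eX) X⊆P
  ... | contains P⊂X = ⊥-elim (P-maximal (X , eX , P⊂X))
  ... | disjoint X∩P-empty = ⊥-elim (X∩P-empty (u , x∈p∩q⁺ (u∈X , u∈P)))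
  ... | crossing X⋈P = ⊥-elim (P-maximal (crossing-extends eP eX X⋈P))

  covered-part : ∀ {u} → InUnionE F g u → ∃[ P ] IsPartOf F g u P
  covered-part (X , eX , u∈X) with Extremal.maximal-above E E? X eX
  ... | P , eP , X⊆P , P-maximal = P , inj₁ (eP , P-maximal) , X⊆P u∈X

  part-of-covered : ∀ {u P} → InUnionE F g u → IsPartOf F g u P → MaximalE F g P
  part-of-covered u-covered (inj₁ P-maximal , _) = P-maximal
  part-of-covered u-covered (inj₂ (v , v-uncovered , refl) , u∈⁅v⁆)
    with x∈⁅y⁆⇒x≡y v u∈⁅v⁆
  ... | refl = ⊥-elim (v-uncovered u-covered)

  maximal-is-d : ∀ {u P} → MaximalE F g P → u ∈ P → IsD F g u (g P)
  maximal-is-d P-maximal@(eP , _) u∈P =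
    ≤-trans (+≤+ (s≤s z≤n)) (proj₁ (proj₂ eP)) ,
    (λ X eX u∈X → maximal-dominates P-maximal eX u∈X u∈P) ,
    inj₂ (_ , eP , u∈P , refl)

  part-of-uncovered : ∀ {u P} → ¬ InUnionE F g u → IsPartOf F g u P → P ≡ ⁅ u ⁆
  part-of-uncovered u-uncovered (inj₁ (eP , _) , u∈P) = ⊥-elim (u-uncovered (_ , eP , u∈P))
  part-of-uncovered u-uncovered (inj₂ (v , _ , refl) , u∈⁅v⁆) with x∈⁅y⁆⇒x≡y v u∈⁅v⁆
  ... | refl = refl

proposition13 : ∀ (n : ℕ) (F : Family n) (g : Subset n → ℤ) →
    IntersectingSupermodular F g →
    (∀ (u : Fin n) → InUnionE F g u →
       (∃[ P ] IsPartOf F g u P) ×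
       (∀ (P : Subset n) → IsPartOf F g u P →
          InE F g P × IsD F g u (g P) × (+ 2 ≤ g P))) ×
    (∀ (u : Fin n) → ¬ InUnionE F g u →
       (∃[ P ] IsPartOf F g u P) ×
       (∀ (P : Subset n) → IsPartOf F g u P → P ≡ ⁅ u ⁆) ×
       IsD F g u (+ 1))
proposition13 n F g SM = covered , uncovered
  where
  open Bunches F g SM
  covered : ∀ (u : Fin n) → InUnionE F g u →
    (∃[ P ] IsPartOf F g u P) ×
    (∀ (P : Subset n) → IsPartOf F g u P → InE F g P × IsD F g u (g P) × (+ 2 ≤ g P))
  covered u u-covered = covered-part u-covered , λ P P-part →
    let P-maximal = part-of-covered u-covered P-part
    in proj₁ P-maximal , maximal-is-d P-maximal (proj₂ P-part) , proj₁ (proj₂ (proj₁ P-maximal))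
  uncovered : ∀ (u : Fin n) → ¬ InUnionE F g u →
    (∃[ P ] IsPartOf F g u P) ×
    (∀ (P : Subset n) → IsPartOf F g u P → P ≡ ⁅ u ⁆) × IsD F g u (+ 1)
  uncovered u u-uncovered =
    (⁅ u ⁆ , inj₂ (u , u-uncovered , refl) , x∈⁅x⁆ u) ,
    (λ P → part-of-uncovered u-uncovered) ,
    (≤-refl , (λ X eX u∈X → ⊥-elim (u-uncovered (X , eX , u∈X))) , inj₁ refl)
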